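{- Let $A\subseteq [m]\times[n]$, where $[k]=\{1,\dots,k\}$, and let $u_1,\dots,u_m$ and $v_1,\dots,v_n$ be nonnegative integers. Then $A$ is colorable with these weights if and only if for every subset $B\subseteq A$, $$\sum_{i\in\pi_1(B)} u_i+\sum_{j\in\pi_2(B)} v_j \;\geq\; |B|,$$ where $\pi_1,\pi_2$ are the projections of $[m]\times[n]$ onto the first and second coordinates.
   Context: Color game: each point $(i,j)\in A$ is to be colored either red or blue; coloring $(i,j)$ red uses one unit of the weight $u_i$ and coloring it blue uses one unit of the weight $v_j$. $A$ is colorable with the given weights if every point of $A$ can be colored so that, for each $i$, the number of red points in $A$ with first coordinate $i$ is at most $u_i$, and for each $j$, the number of blue points with second coordinate $j$ is at most $v_j$. -}

module Defs where

open import Data.Nat using (ℕ; zero; suc; _+_; _≤_)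
open import Data.Fin using (Fin; zero; suc)
open import Data.Bool using (Bool; true; false; _∧_; _∨_; not; T)
open import Data.Product using (_×_)

sumFin : (k : ℕ) → (Fin k → ℕ) → ℕ
sumFin zero    f = 0
sumFin (suc k) f = f zero + sumFin k (λ i → f (suc i))

anyFin : (k : ℕ) → (Fin k → Bool) → Bool
anyFin zero    p = false
anyFin (suc k) p = p zero ∨ anyFin k (λ i → p (suc i))

𝟙 : Bool → ℕ
𝟙 true  = 1
𝟙 false = 0

-- A subset of [m]×[n] is a Boolean-valued predicate (index 0 ↔ 1, etc.).
Grid : ℕ → ℕ → Set
Grid m n = Fin m → Fin n → Bool

_⊆G_ : ∀ {m n} → Grid m n → Grid m n → Set
_⊆G_ {m} {n} B A = (i : Fin m) (j : Fin n) → T (B i j) → T (A i j)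

card : ∀ {m n} → Grid m n → ℕ
card {m} {n} B = sumFin m (λ i → sumFin n (λ j → 𝟙 (B i j)))

π₁ : ∀ {m n} → Grid m n → Fin m → Bool
π₁ {m} {n} B i = anyFin n (λ j → B i j)

π₂ : ∀ {m n} → Grid m n → Fin n → Bool
π₂ {m} {n} B j = anyFin m (λ i → B i j)

-- A colouring assigns each point a colour: true = red, false = blue.
-- (Values off A are irrelevant.)
Coloring : ℕ → ℕ → Set
Coloring m n = Fin m → Fin n → Bool

ValidColoring : ∀ {m n} → Grid m n → (Fin m → ℕ) → (Fin n → ℕ) → Coloring m n → Set
ValidColoring {m} {n} A u v c =
  ((i : Fin m) → sumFin n (λ j → 𝟙 (A i j ∧ c i j)) ≤ u i) ×
  ((j : Fin n) → sumFin m (λ i → 𝟙 (A i j ∧ not (c i j))) ≤ v j)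

Colorable : ∀ {m n} → Grid m n → (Fin m → ℕ) → (Fin n → ℕ) → Set
Colorable {m} {n} A u v = Data.Product.Σ (Coloring m n) (ValidColoring A u v)
  where import Data.Product

HallCondition : ∀ {m n} → (Fin m → ℕ) → (Fin n → ℕ) → Grid m n → Set
HallCondition {m} {n} u v B =
  card B ≤ sumFin m (λ i → if π₁ B i then u i else 0)
         + sumFin n (λ j → if π₂ B j then v j else 0)
  where open import Data.Bool using (if_then_else_)

module Submission where

-- Only sufficiency of the Hall condition needs work. The capacity u(π₁ B) + v(π₂ B) of B
-- depends only on its projections, so it suffices to look at the blocks A ∩ (P × Q):
-- such a block is overloaded when its load |A ∩ (P × Q)| exceeds its capacity u(P) + v(Q).
-- Induct on |A|. Pick a point p = (i , j) of A and colour A ∖ {p} by induction, once with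
-- u i lowered by one (so that p can be red) and once with v j lowered (so that p can be
-- blue). If both attempts fail, A ∖ {p} has a tight block (load ≥ capacity) through row i
-- and one through column j. Capacity is modular and load supermodular in the block, so
-- either the intersection of the two blocks is overloaded, or their union is tight and
-- becomes overloaded once p is put back.

open import Defs
open import Data.Nat using (ℕ)
open import Data.Fin using (Fin)
open import Function.Bundles using (_⇔_; mk⇔)

open import Data.Bool using (Bool; true; false; _∧_; _∨_; not; T; if_then_else_)
open import Data.Bool.Properties using (T?; ∧-comm; not-involutive)
open import Data.Empty using (⊥-elim)
open import Data.Fin using (zero; suc)
open import Data.Fin.Properties using (_≟_; any?)
open import Data.Nat using (zero; suc; pred; _+_; _≤_; _<_; z≤n; s≤s; _≤?_)
open import Data.Nat.Properties hiding (_≟_)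
open import Algebra.Properties.CommutativeSemigroup +-commutativeSemigroup using (interchange)
open import Data.Product using (Σ; _×_; _,_; proj₁; proj₂)
open import Data.Sum using (_⊎_; inj₁; inj₂)
import Data.Sum as Sum
open import Data.Unit using (tt)
open import Data.Vec.Functional using (updateAt)
open import Data.Vec.Functional.Properties using (updateAt-updates; updateAt-minimal)
open import Function.Base using (_∘_; id)
open import Relation.Nullary using (¬_; yes; no; does)
open import Relation.Binary.PropositionalEquality
  using (_≡_; refl; sym; trans; cong; cong₂; subst; subst₂; module ≡-Reasoning)

private variable
  k m n : ℕ

∧-intro : ∀ a {b} → T a → T b → T (a ∧ b)
∧-intro true _ tb = tb

∧-elim : ∀ a {b} → T (a ∧ b) → T a × T b
∧-elim true tb = tt , tb

∨-introˡ : ∀ a {b} → T a → T (a ∨ b)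
∨-introˡ true _ = tt

∨-introʳ : ∀ a {b} → T b → T (a ∨ b)
∨-introʳ true  _  = tt
∨-introʳ false tb = tb

∨-elim : ∀ a {b} → T (a ∨ b) → T a ⊎ T b
∨-elim true  _  = inj₁ tt
∨-elim false tb = inj₂ tb

𝟙-mono : ∀ a b → (T a → T b) → 𝟙 a ≤ 𝟙 b
𝟙-mono false _     _   = z≤n
𝟙-mono true  true  _   = ≤-refl
𝟙-mono true  false a⇒b = ⊥-elim (a⇒b tt)

𝟙-< : ∀ a b → ¬ T a → T b → 𝟙 a < 𝟙 b
𝟙-< true  _     ¬a _ = ⊥-elim (¬a tt)
𝟙-< false true  _  _ = ≤-refl
𝟙-< false false _  ()

𝟙-∨ : ∀ a b → 𝟙 (a ∨ b) ≤ 𝟙 a + 𝟙 b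
𝟙-∨ true  _ = s≤s z≤n
𝟙-∨ false _ = ≤-refl

𝟙-+-≤ : ∀ x y z w → (T x → T z) → (T y → T z) → (T x → T y → T w) → 𝟙 x + 𝟙 y ≤ 𝟙 z + 𝟙 w
𝟙-+-≤ false false _ _ _   _   _    = z≤n
𝟙-+-≤ true  false z _ x⇒z _   _    = ≤-trans (𝟙-mono true z x⇒z) (m≤m+n _ _)
𝟙-+-≤ false true  z _ _   y⇒z _    = ≤-trans (𝟙-mono true z y⇒z) (m≤m+n _ _)
𝟙-+-≤ true  true  z w x⇒z _   xy⇒w = +-mono-≤ (𝟙-mono true z x⇒z) (𝟙-mono true w (xy⇒w tt))

𝟙-split : ∀ a c → 𝟙 a ≡ 𝟙 (a ∧ c) + 𝟙 (a ∧ not c)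
𝟙-split false _     = refl
𝟙-split true  true  = refl
𝟙-split true  false = refl

𝟙-∧ : ∀ a b → 𝟙 (a ∧ b) ≡ (if b then 𝟙 a else 0)
𝟙-∧ false false = refl
𝟙-∧ false true  = refl
𝟙-∧ true  false = refl
𝟙-∧ true  true  = refl

if-𝟙-comm : ∀ a b → (if a then 𝟙 b else 0) ≡ (if b then 𝟙 a else 0)
if-𝟙-comm false false = refl
if-𝟙-comm false true  = refl
if-𝟙-comm true  false = refl
if-𝟙-comm true  true  = refl

if-mono : ∀ a b {x} → (T a → T b) → (if a then x else 0) ≤ (if b then x else 0)
if-mono false _     _   = z≤n
if-mono true  true  _   = ≤-refl
if-mono true  false a⇒b = ⊥-elim (a⇒b tt)

if-+ : ∀ b x y → (if b then x + y else 0) ≡ (if b then x else 0) + (if b then y else 0)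
if-+ true  _ _ = refl
if-+ false _ _ = refl

if-∨-∧ : ∀ a b x →
  (if a ∨ b then x else 0) + (if a ∧ b then x else 0) ≡ (if a then x else 0) + (if b then x else 0)
if-∨-∧ true  _ _ = refl
if-∨-∧ false b x = +-identityʳ (if b then x else 0)

sumFin-cong : ∀ k {f g : Fin k → ℕ} → (∀ x → f x ≡ g x) → sumFin k f ≡ sumFin k g
sumFin-cong zero    f≡g = refl
sumFin-cong (suc k) f≡g = cong₂ _+_ (f≡g zero) (sumFin-cong k (f≡g ∘ suc))

sumFin-mono : ∀ k {f g : Fin k → ℕ} → (∀ x → f x ≤ g x) → sumFin k f ≤ sumFin k g
sumFin-mono zero    f≤g = z≤n
sumFin-mono (suc k) f≤g = +-mono-≤ (f≤g zero) (sumFin-mono k (f≤g ∘ suc))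

sumFin-< : ∀ k {f g : Fin k → ℕ} → (∀ x → f x ≤ g x) → ∀ x₀ → f x₀ < g x₀ → sumFin k f < sumFin k g
sumFin-< (suc k) f≤g zero     f<g = +-mono-<-≤ f<g (sumFin-mono k (f≤g ∘ suc))
sumFin-< (suc k) f≤g (suc x₀) f<g = +-mono-≤-< (f≤g zero) (sumFin-< k (f≤g ∘ suc) x₀ f<g)

sumFin-zero : ∀ k → sumFin k (λ _ → 0) ≡ 0
sumFin-zero zero    = refl
sumFin-zero (suc k) = sumFin-zero k

sumFin-distrib-+ : ∀ k (f g : Fin k → ℕ) → sumFin k (λ x → f x + g x) ≡ sumFin k f + sumFin k g
sumFin-distrib-+ zero    f g = refl
sumFin-distrib-+ (suc k) f g =
  trans (cong (f zero + g zero +_) (sumFin-distrib-+ k (f ∘ suc) (g ∘ suc)))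
        (interchange (f zero) (g zero) (sumFin k (f ∘ suc)) (sumFin k (g ∘ suc)))

sumFin-comm : ∀ m n (f : Fin m → Fin n → ℕ) →
  sumFin m (λ x → sumFin n (f x)) ≡ sumFin n (λ y → sumFin m (λ x → f x y))
sumFin-comm zero    n f = sym (sumFin-zero n)
sumFin-comm (suc m) n f =
  trans (cong (sumFin n (f zero) +_) (sumFin-comm m n (f ∘ suc)))
        (sym (sumFin-distrib-+ n (f zero) (λ y → sumFin m (λ x → f (suc x) y))))

sumFin-point : ∀ k (i : Fin k) (f : Fin k → ℕ) → sumFin k (λ x → if does (x ≟ i) then f x else 0) ≡ f i
sumFin-point (suc k) zero    f = trans (cong (f zero +_) (sumFin-zero k)) (+-identityʳ (f zero))
sumFin-point (suc k) (suc i) f = sumFin-point k i (f ∘ suc)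

-- Subsets of Fin k: cardinality and weight

_⊆_ : (Fin k → Bool) → (Fin k → Bool) → Set
P ⊆ Q = ∀ x → T (P x) → T (Q x)

_∪_ _∩_ : (Fin k → Bool) → (Fin k → Bool) → Fin k → Bool
(P ∪ Q) x = P x ∨ Q x
(P ∩ Q) x = P x ∧ Q x

∅ : Fin k → Bool
∅ _ = false

⁅_⁆ : Fin k → Fin k → Bool
⁅ i ⁆ x = does (x ≟ i)

i∈⁅i⁆ : (i : Fin k) → T (⁅ i ⁆ i)
i∈⁅i⁆ i with i ≟ i
... | yes _  = tt
... | no i≢i = i≢i refl

count : (k : ℕ) → (Fin k → Bool) → ℕ
count k P = sumFin k (𝟙 ∘ P)

weight : (Fin k → ℕ) → (Fin k → Bool) → ℕ
weight {k} u P = sumFin k (λ x → if P x then u x else 0)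

count-mono : ∀ k {P Q : Fin k → Bool} → P ⊆ Q → count k P ≤ count k Q
count-mono k {P} {Q} P⊆Q = sumFin-mono k (λ x → 𝟙-mono (P x) (Q x) (P⊆Q x))

count-none : ∀ k {P : Fin k → Bool} → (∀ x → ¬ T (P x)) → count k P ≤ 0
count-none k none = ≤-trans (count-mono k {Q = ∅} none) (≤-reflexive (sumFin-zero k))

count-∪ : ∀ k (P Q : Fin k → Bool) → count k (P ∪ Q) ≤ count k P + count k Q
count-∪ k P Q = ≤-trans (sumFin-mono k (λ x → 𝟙-∨ (P x) (Q x)))
                        (≤-reflexive (sumFin-distrib-+ k (𝟙 ∘ P) (𝟙 ∘ Q)))

anyFin-intro : ∀ k (P : Fin k → Bool) x → T (P x) → T (anyFin k P)
anyFin-intro (suc k) P zero    Px = ∨-introˡ (P zero) Px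
anyFin-intro (suc k) P (suc x) Px = ∨-introʳ (P zero) (anyFin-intro k (P ∘ suc) x Px)

anyFin-witness : ∀ k (P : Fin k → Bool) → T (anyFin k P) → Σ (Fin k) (T ∘ P)
anyFin-witness (suc k) P any with ∨-elim (P zero) any
... | inj₁ P₀   = zero , P₀
... | inj₂ any′ with anyFin-witness k (P ∘ suc) any′
...   | x , Px = suc x , Px

count-∩-≤ : ∀ k {R S : Fin k → Bool} (c : Fin k → Bool) {a : ℕ} → R ⊆ S →
  count k (S ∩ c) ≤ a → count k (R ∩ c) ≤ (if anyFin k R then a else 0)
count-∩-≤ k {R} {S} c R⊆S S∩c≤a with anyFin k R in any≡
... | true  = ≤-trans (count-mono k R∩c⊆S∩c) S∩c≤a
  where
  R∩c⊆S∩c : (R ∩ c) ⊆ (S ∩ c)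
  R∩c⊆S∩c x Rcx = let (Rx , cx) = ∧-elim (R x) Rcx in ∧-intro (S x) (R⊆S x Rx) cx
... | false = count-none k (λ x Rcx → subst T any≡ (anyFin-intro k R x (proj₁ (∧-elim (R x) Rcx))))

weight-mono : ∀ (u : Fin k → ℕ) {P Q} → P ⊆ Q → weight u P ≤ weight u Q
weight-mono {k} u {P} {Q} P⊆Q = sumFin-mono k (λ x → if-mono (P x) (Q x) (P⊆Q x))

weight-+ : ∀ (f g : Fin k → ℕ) P → weight (λ x → f x + g x) P ≡ weight f P + weight g P
weight-+ {k} f g P = trans (sumFin-cong k (λ x → if-+ (P x) (f x) (g x))) (sumFin-distrib-+ k _ _)

weight-modular : ∀ (u : Fin k → ℕ) P Q → weight u (P ∪ Q) + weight u (P ∩ Q) ≡ weight u P + weight u Q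
weight-modular {k} u P Q =
  trans (sym (sumFin-distrib-+ k _ _))
        (trans (sumFin-cong k (λ x → if-∨-∧ (P x) (Q x) (u x))) (sumFin-distrib-+ k _ _))

weight-⁅⁆ : ∀ (u : Fin k → ℕ) i → weight u ⁅ i ⁆ ≡ u i
weight-⁅⁆ {k} u i = sumFin-point k i u

weight-unit : ∀ (i : Fin k) P → weight (𝟙 ∘ ⁅ i ⁆) P ≡ 𝟙 (P i)
weight-unit {k} i P = trans (sumFin-cong k (λ x → if-𝟙-comm (P x) (⁅ i ⁆ x))) (sumFin-point k i (𝟙 ∘ P))

weight-shift : ∀ {u u′ : Fin k → ℕ} i → (∀ x → u x ≡ 𝟙 (⁅ i ⁆ x) + u′ x) →
  ∀ P → weight u P ≡ 𝟙 (P i) + weight u′ P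
weight-shift {k} {u} {u′} i u≡ P = begin
  weight u P                              ≡⟨ sumFin-cong k (λ x → cong (λ a → if P x then a else 0) (u≡ x)) ⟩
  weight (λ x → 𝟙 (⁅ i ⁆ x) + u′ x) P     ≡⟨ weight-+ (𝟙 ∘ ⁅ i ⁆) u′ P ⟩
  weight (𝟙 ∘ ⁅ i ⁆) P + weight u′ P      ≡⟨ cong (_+ weight u′ P) (weight-unit i P) ⟩
  𝟙 (P i) + weight u′ P                   ∎
  where open ≡-Reasoning

-- Grids and blocks

_∪G_ _∩G_ : Grid m n → Grid m n → Grid m n
(A ∪G B) x = A x ∪ B x
(A ∩G B) x = A x ∩ B x

_ᵀ : Grid m n → Grid n m
(A ᵀ) y x = A x y

_∖⁅_,_⁆ : Grid m n → Fin m → Fin n → Grid m n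
(A ∖⁅ i , j ⁆) x y = A x y ∧ not (⁅ i ⁆ x ∧ ⁅ j ⁆ y)

∖-⊆ : (A : Grid m n) (i : Fin m) (j : Fin n) → (A ∖⁅ i , j ⁆) ⊆G A
∖-⊆ A i j x y = proj₁ ∘ ∧-elim (A x y)

∖-∉ : (A : Grid m n) (i : Fin m) (j : Fin n) → ¬ T ((A ∖⁅ i , j ⁆) i j)
∖-∉ A i j with i ≟ i | j ≟ j
... | yes _  | yes _  = proj₂ ∘ ∧-elim (A i j)
... | no i≢i | _      = λ _ → i≢i refl
... | yes _  | no j≢j = λ _ → j≢j refl

card-mono : (A B : Grid m n) → B ⊆G A → card B ≤ card A
card-mono {m} {n} A B B⊆A = sumFin-mono m (λ x → count-mono n (B⊆A x))

card-< : (A B : Grid m n) {i : Fin m} {j : Fin n} → B ⊆G A → T (A i j) → ¬ T (B i j) → card B < card A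
card-< {m} {n} A B {i} {j} B⊆A Aᵢⱼ Bᵢⱼ∉ =
  sumFin-< m (λ x → count-mono n (B⊆A x)) i
    (sumFin-< n (λ y → 𝟙-mono (B i y) (A i y) (B⊆A i y)) j (𝟙-< (B i j) (A i j) Bᵢⱼ∉ Aᵢⱼ))

block : Grid m n → (Fin m → Bool) → (Fin n → Bool) → Grid m n
block A P Q x y = A x y ∧ (P x ∧ Q y)

∧³-mono : ∀ a a′ p p′ q q′ → (T a → T a′) → (T p → T p′) → (T q → T q′) → T (a ∧ (p ∧ q)) → T (a′ ∧ (p′ ∧ q′))
∧³-mono true  a′ true  p′ true  q′ a⇒ p⇒ q⇒ _ = ∧-intro a′ (a⇒ tt) (∧-intro p′ (p⇒ tt) (q⇒ tt))
∧³-mono false _  _     _  _     _  _  _  _  ()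
∧³-mono true  _  false _  _     _  _  _  _  ()
∧³-mono true  _  true  _  false _  _  _  _  ()

∧³-∩ : ∀ a₁ a₂ p₁ p₂ q₁ q₂ → T (a₁ ∧ (p₁ ∧ q₁)) → T (a₂ ∧ (p₂ ∧ q₂)) → T ((a₁ ∧ a₂) ∧ ((p₁ ∧ p₂) ∧ (q₁ ∧ q₂)))
∧³-∩ true  _ true  _ true  _ _ in₂ = in₂
∧³-∩ false _ _     _ _     _ ()
∧³-∩ true  _ false _ _     _ ()
∧³-∩ true  _ true  _ false _ ()

load : Grid m n → (Fin m → Bool) → (Fin n → Bool) → ℕ
load A P Q = card (block A P Q)

capacity : (Fin m → ℕ) → (Fin n → ℕ) → (Fin m → Bool) → (Fin n → Bool) → ℕ
capacity u v P Q = weight u P + weight v Q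

load-mono : (A B : Grid m n) (P : Fin m → Bool) (Q : Fin n → Bool) → B ⊆G A → load B P Q ≤ load A P Q
load-mono A B P Q B⊆A = card-mono (block A P Q) (block B P Q)
  (λ x y → ∧³-mono (B x y) (A x y) (P x) (P x) (Q y) (Q y) (B⊆A x y) (λ Px → Px) (λ Qy → Qy))

load-supermodular : (A₁ A₂ : Grid m n) (P₁ P₂ : Fin m → Bool) (Q₁ Q₂ : Fin n → Bool) →
  load A₁ P₁ Q₁ + load A₂ P₂ Q₂ ≤
  load (A₁ ∪G A₂) (P₁ ∪ P₂) (Q₁ ∪ Q₂) + load (A₁ ∩G A₂) (P₁ ∩ P₂) (Q₁ ∩ Q₂)
load-supermodular {m} {n} A₁ A₂ P₁ P₂ Q₁ Q₂ = begin
  card B₁ + card B₂                      ≡⟨ card-+ B₁ B₂ ⟩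
  Σ² (λ x y → 𝟙 (B₁ x y) + 𝟙 (B₂ x y))   ≤⟨ sumFin-mono m (λ x → sumFin-mono n (pointwise x)) ⟩
  Σ² (λ x y → 𝟙 (B∪ x y) + 𝟙 (B∩ x y))   ≡⟨ card-+ B∪ B∩ ⟨
  card B∪ + card B∩                      ∎
  where
  open ≤-Reasoning
  B₁ B₂ B∪ B∩ : Grid m n
  B₁ = block A₁ P₁ Q₁
  B₂ = block A₂ P₂ Q₂
  B∪ = block (A₁ ∪G A₂) (P₁ ∪ P₂) (Q₁ ∪ Q₂)
  B∩ = block (A₁ ∩G A₂) (P₁ ∩ P₂) (Q₁ ∩ Q₂)
  Σ² : (Fin m → Fin n → ℕ) → ℕ
  Σ² f = sumFin m (λ x → sumFin n (f x))
  card-+ : (B C : Grid m n) → card B + card C ≡ Σ² (λ x y → 𝟙 (B x y) + 𝟙 (C x y))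
  card-+ B C = trans (sym (sumFin-distrib-+ m _ _)) (sumFin-cong m (λ x → sym (sumFin-distrib-+ n _ _)))
  pointwise : ∀ x y → 𝟙 (B₁ x y) + 𝟙 (B₂ x y) ≤ 𝟙 (B∪ x y) + 𝟙 (B∩ x y)
  pointwise x y = 𝟙-+-≤ (B₁ x y) (B₂ x y) (B∪ x y) (B∩ x y)
    (∧³-mono (A₁ x y) _ (P₁ x) _ (Q₁ y) _ (∨-introˡ (A₁ x y)) (∨-introˡ (P₁ x)) (∨-introˡ (Q₁ y)))
    (∧³-mono (A₂ x y) _ (P₂ x) _ (Q₂ y) _ (∨-introʳ (A₁ x y)) (∨-introʳ (P₁ x)) (∨-introʳ (Q₁ y)))
    (∧³-∩ (A₁ x y) (A₂ x y) (P₁ x) (P₂ x) (Q₁ y) (Q₂ y))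

load-transpose : (A : Grid m n) (P : Fin m → Bool) (Q : Fin n → Bool) → load (A ᵀ) Q P ≡ load A P Q
load-transpose {m} {n} A P Q =
  trans (sym (sumFin-comm m n _))
        (sumFin-cong m (λ x → sumFin-cong n (λ y → cong (λ b → 𝟙 (A x y ∧ b)) (∧-comm (Q y) (P x)))))

capacity-modular : (u : Fin m → ℕ) (v : Fin n → ℕ) (P₁ P₂ : Fin m → Bool) (Q₁ Q₂ : Fin n → Bool) →
  capacity u v (P₁ ∪ P₂) (Q₁ ∪ Q₂) + capacity u v (P₁ ∩ P₂) (Q₁ ∩ Q₂) ≡
  capacity u v P₁ Q₁ + capacity u v P₂ Q₂
capacity-modular u v P₁ P₂ Q₁ Q₂ = begin
  (weight u (P₁ ∪ P₂) + weight v (Q₁ ∪ Q₂)) + (weight u (P₁ ∩ P₂) + weight v (Q₁ ∩ Q₂))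
    ≡⟨ interchange (weight u (P₁ ∪ P₂)) _ _ _ ⟩
  (weight u (P₁ ∪ P₂) + weight u (P₁ ∩ P₂)) + (weight v (Q₁ ∪ Q₂) + weight v (Q₁ ∩ Q₂))
    ≡⟨ cong₂ _+_ (weight-modular u P₁ P₂) (weight-modular v Q₁ Q₂) ⟩
  (weight u P₁ + weight u P₂) + (weight v Q₁ + weight v Q₂)
    ≡⟨ interchange (weight u P₁) _ _ _ ⟩
  (weight u P₁ + weight v Q₁) + (weight u P₂ + weight v Q₂) ∎
  where open ≡-Reasoning

Tight : Grid m n → (Fin m → ℕ) → (Fin n → ℕ) → (Fin m → Bool) → (Fin n → Bool) → Set
Tight A u v P Q = capacity u v P Q ≤ load A P Q

Overloaded : Grid m n → (Fin m → ℕ) → (Fin n → ℕ) → Set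
Overloaded {m} {n} A u v = Σ (Fin m → Bool) λ P → Σ (Fin n → Bool) λ Q → capacity u v P Q < load A P Q

TightBlockThroughRow : Grid m n → (Fin m → ℕ) → (Fin n → ℕ) → Fin m → Set
TightBlockThroughRow {m} {n} A u v i = Σ (Fin m → Bool) λ P → Σ (Fin n → Bool) λ Q → T (P i) × Tight A u v P Q

ColorableOrOverloaded : Grid m n → (Fin m → ℕ) → (Fin n → ℕ) → Set
ColorableOrOverloaded A u v = Colorable A u v ⊎ Overloaded A u v

tight-transpose : (A : Grid m n) {u : Fin m → ℕ} {v : Fin n → ℕ} (P : Fin m → Bool) (Q : Fin n → Bool) →
  Tight A u v P Q → Tight (A ᵀ) v u Q P
tight-transpose A {u} {v} P Q = subst₂ _≤_ (+-comm (weight u P) (weight v Q)) (sym (load-transpose A P Q))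

overloaded-transpose : (A : Grid m n) {u : Fin m → ℕ} {v : Fin n → ℕ} →
  Overloaded A u v → Overloaded (A ᵀ) v u
overloaded-transpose A {u} {v} (P , Q , over) =
  Q , P , subst₂ _<_ (+-comm (weight u P) (weight v Q)) (sym (load-transpose A P Q)) over

colorable-transpose : (A : Grid m n) {u : Fin m → ℕ} {v : Fin n → ℕ} → Colorable A u v → Colorable (A ᵀ) v u
colorable-transpose {n = n} A {u} (c , red≤ , blue≤) = (λ y x → not (c x y)) , blue≤ , red≤′
  where
  red≤′ : ∀ x → count n (λ y → A x y ∧ not (not (c x y))) ≤ u x
  red≤′ x = subst (_≤ u x)
    (sumFin-cong n (λ y → cong (λ b → 𝟙 (A x y ∧ b)) (sym (not-involutive (c x y))))) (red≤ x)

colorableOrOverloaded-transpose : (A : Grid m n) {u : Fin m → ℕ} {v : Fin n → ℕ} →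
  ColorableOrOverloaded A u v → ColorableOrOverloaded (A ᵀ) v u
colorableOrOverloaded-transpose A = Sum.map (colorable-transpose A) (overloaded-transpose A)

paint-red : (A : Grid m n) (i : Fin m) (j : Fin n) {u u′ : Fin m → ℕ} {v : Fin n → ℕ} {c′ : Coloring m n} →
  (∀ x → u x ≡ 𝟙 (⁅ i ⁆ x) + u′ x) → ValidColoring (A ∖⁅ i , j ⁆) u′ v c′ →
  ValidColoring A u v (λ x y → (⁅ i ⁆ x ∧ ⁅ j ⁆ y) ∨ c′ x y)
paint-red {m} {n} A i j {u} {u′} {v} {c′} u≡ (red≤ , blue≤) = red≤′ , blue≤′
  where
  open ≤-Reasoning
  A′ : Grid m n
  A′ = A ∖⁅ i , j ⁆
  stays-red : ∀ a e c → T (a ∧ (e ∨ c)) → T (e ∨ ((a ∧ not e) ∧ c))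
  stays-red true  true  _ _ = tt
  stays-red true  false _ t = t
  stays-red false _     _ ()
  stays-blue : ∀ a e c → T (a ∧ not (e ∨ c)) → T ((a ∧ not e) ∧ not c)
  stays-blue true  false _ t = t
  stays-blue true  true  _ ()
  stays-blue false _     _ ()
  red≤′ : ∀ x → count n (λ y → A x y ∧ ((⁅ i ⁆ x ∧ ⁅ j ⁆ y) ∨ c′ x y)) ≤ u x
  red≤′ x = begin
    count n (λ y → A x y ∧ ((⁅ i ⁆ x ∧ ⁅ j ⁆ y) ∨ c′ x y))
      ≤⟨ count-mono n (λ y → stays-red (A x y) (⁅ i ⁆ x ∧ ⁅ j ⁆ y) (c′ x y)) ⟩
    count n ((λ y → ⁅ i ⁆ x ∧ ⁅ j ⁆ y) ∪ (λ y → A′ x y ∧ c′ x y))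
      ≤⟨ count-∪ n _ _ ⟩
    count n (λ y → ⁅ i ⁆ x ∧ ⁅ j ⁆ y) + count n (λ y → A′ x y ∧ c′ x y)
      ≤⟨ +-mono-≤ (≤-reflexive point-row) (red≤ x) ⟩
    𝟙 (⁅ i ⁆ x) + u′ x
      ≡⟨ u≡ x ⟨
    u x ∎
    where
    point-row : count n (λ y → ⁅ i ⁆ x ∧ ⁅ j ⁆ y) ≡ 𝟙 (⁅ i ⁆ x)
    point-row = trans (sumFin-cong n (λ y → 𝟙-∧ (⁅ i ⁆ x) (⁅ j ⁆ y))) (sumFin-point n j (λ _ → 𝟙 (⁅ i ⁆ x)))
  blue≤′ : ∀ y → count m (λ x → A x y ∧ not ((⁅ i ⁆ x ∧ ⁅ j ⁆ y) ∨ c′ x y)) ≤ v y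
  blue≤′ y = ≤-trans (count-mono m (λ x → stays-blue (A x y) (⁅ i ⁆ x ∧ ⁅ j ⁆ y) (c′ x y))) (blue≤ y)

lowered-overload⇒overloaded-or-tight : (A B : Grid m n) (i : Fin m) {u u′ : Fin m → ℕ} {v : Fin n → ℕ} → B ⊆G A →
  (∀ x → u x ≡ 𝟙 (⁅ i ⁆ x) + u′ x) → Overloaded B u′ v → Overloaded A u v ⊎ TightBlockThroughRow B u v i
lowered-overload⇒overloaded-or-tight A B i {u} {u′} {v} B⊆A u≡ (P , Q , over) with P i in Pᵢ≡ | capacity-shift
  where
  capacity-shift : capacity u v P Q ≡ 𝟙 (P i) + capacity u′ v P Q
  capacity-shift = trans (cong (_+ weight v Q) (weight-shift i u≡ P))
                         (+-assoc (𝟙 (P i)) (weight u′ P) (weight v Q))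
... | true  | shift = inj₂ (P , Q , subst T (sym Pᵢ≡) tt , ≤-trans (≤-reflexive shift) over)
... | false | shift = inj₁ (P , Q , <-≤-trans (≤-<-trans (≤-reflexive shift) over) (load-mono A B P Q B⊆A))

updateAt-pred-decomposition : (u : Fin k → ℕ) (i : Fin k) {w : ℕ} → u i ≡ suc w →
  ∀ x → u x ≡ 𝟙 (⁅ i ⁆ x) + updateAt u i pred x
updateAt-pred-decomposition u i uᵢ≡ x with x ≟ i
... | yes refl = trans uᵢ≡ (cong suc (sym (trans (updateAt-updates i u) (cong pred uᵢ≡))))
... | no  x≢i  = sym (updateAt-minimal x i u x≢i)

try-paint-red : (A : Grid m n) (u : Fin m → ℕ) (v : Fin n → ℕ) (i : Fin m) (j : Fin n) →
  ((u′ : Fin m → ℕ) → ColorableOrOverloaded (A ∖⁅ i , j ⁆) u′ v) →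
  ColorableOrOverloaded A u v ⊎ TightBlockThroughRow (A ∖⁅ i , j ⁆) u v i
try-paint-red {n = n} A u v i j recurse with u i in uᵢ≡
... | zero  = inj₂ (⁅ i ⁆ , ∅ , i∈⁅i⁆ i , ≤-trans (≤-reflexive capacity≡0) z≤n)
  where
  capacity≡0 : capacity u v ⁅ i ⁆ ∅ ≡ 0
  capacity≡0 = cong₂ _+_ (trans (weight-⁅⁆ u i) uᵢ≡) (sumFin-zero n)
... | suc _ = extend (updateAt-pred-decomposition u i uᵢ≡) (recurse (updateAt u i pred))
  where
  extend : ∀ {u′} → (∀ x → u x ≡ 𝟙 (⁅ i ⁆ x) + u′ x) → ColorableOrOverloaded (A ∖⁅ i , j ⁆) u′ v →
    ColorableOrOverloaded A u v ⊎ TightBlockThroughRow (A ∖⁅ i , j ⁆) u v i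
  extend u≡ (inj₁ (_ , valid′)) = inj₁ (inj₁ (_ , paint-red A i j u≡ valid′))
  extend u≡ (inj₂ over′)        = Sum.map₁ inj₂ (lowered-overload⇒overloaded-or-tight A (A ∖⁅ i , j ⁆) i (∖-⊆ A i j) u≡ over′)

tight-row-and-column⇒overloaded : (A A₁ A₂ : Grid m n) {u : Fin m → ℕ} {v : Fin n → ℕ}
  {i : Fin m} {j : Fin n} →
  A₁ ⊆G A → A₂ ⊆G A → T (A i j) → ¬ T (A₁ i j) → ¬ T (A₂ i j) →
  TightBlockThroughRow A₁ u v i → TightBlockThroughRow (A₂ ᵀ) v u j → Overloaded A u v
tight-row-and-column⇒overloaded {m} {n} A A₁ A₂ {u} {v} {i} {j} A₁⊆A A₂⊆A Aᵢⱼ A₁ᵢⱼ∉ A₂ᵢⱼ∉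
  (P₁ , Q₁ , P₁ᵢ , tight₁) (Q₂ , P₂ , Q₂ⱼ , tight₂)
  with load (A₁ ∩G A₂) (P₁ ∩ P₂) (Q₁ ∩ Q₂) ≤? capacity u v (P₁ ∩ P₂) (Q₁ ∩ Q₂)
... | no  ¬fits = P₁ ∩ P₂ , Q₁ ∩ Q₂ , <-≤-trans (≰⇒> ¬fits)
                    (load-mono A (A₁ ∩G A₂) (P₁ ∩ P₂) (Q₁ ∩ Q₂) (λ x y → A₁⊆A x y ∘ proj₁ ∘ ∧-elim (A₁ x y)))
... | yes fits  = P₁ ∪ P₂ , Q₁ ∪ Q₂ , ≤-<-trans capacity∪≤load∪ load∪<
  where
  open ≤-Reasoning
  A∩ A∪ : Grid m n
  A∩ = A₁ ∩G A₂
  A∪ = A₁ ∪G A₂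
  P∩ P∪ : Fin m → Bool
  P∩ = P₁ ∩ P₂
  P∪ = P₁ ∪ P₂
  Q∩ Q∪ : Fin n → Bool
  Q∩ = Q₁ ∩ Q₂
  Q∪ = Q₁ ∪ Q₂
  capacity∪≤load∪ : capacity u v P∪ Q∪ ≤ load A∪ P∪ Q∪
  capacity∪≤load∪ = +-cancelʳ-≤ _ _ _ (begin
    capacity u v P∪ Q∪ + capacity u v P∩ Q∩    ≡⟨ capacity-modular u v P₁ P₂ Q₁ Q₂ ⟩
    capacity u v P₁ Q₁ + capacity u v P₂ Q₂    ≤⟨ +-mono-≤ tight₁ (tight-transpose (A₂ ᵀ) Q₂ P₂ tight₂) ⟩
    load A₁ P₁ Q₁ + load A₂ P₂ Q₂              ≤⟨ load-supermodular A₁ A₂ P₁ P₂ Q₁ Q₂ ⟩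
    load A∪ P∪ Q∪ + load A∩ P∩ Q∩              ≤⟨ +-monoʳ-≤ (load A∪ P∪ Q∪) fits ⟩
    load A∪ P∪ Q∪ + capacity u v P∩ Q∩         ∎)
  load∪< : load A∪ P∪ Q∪ < load A P∪ Q∪
  load∪< = card-< (block A P∪ Q∪) (block A∪ P∪ Q∪)
    (λ x y → ∧³-mono (A∪ x y) (A x y) (P∪ x) (P∪ x) (Q∪ y) (Q∪ y) (A∪⊆A x y) (λ p → p) (λ q → q))
    (∧-intro (A i j) Aᵢⱼ (∧-intro (P∪ i) (∨-introˡ (P₁ i) P₁ᵢ) (∨-introʳ (Q₁ j) Q₂ⱼ)))
    (A₁∪A₂ᵢⱼ∉ ∘ proj₁ ∘ ∧-elim (A∪ i j))
    where
    A∪⊆A : A∪ ⊆G A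
    A∪⊆A x y A∪ₓᵧ with ∨-elim (A₁ x y) A∪ₓᵧ
    ... | inj₁ A₁ₓᵧ = A₁⊆A x y A₁ₓᵧ
    ... | inj₂ A₂ₓᵧ = A₂⊆A x y A₂ₓᵧ
    A₁∪A₂ᵢⱼ∉ : ¬ T (A∪ i j)
    A₁∪A₂ᵢⱼ∉ A∪ᵢⱼ with ∨-elim (A₁ i j) A∪ᵢⱼ
    ... | inj₁ A₁ᵢⱼ = A₁ᵢⱼ∉ A₁ᵢⱼ
    ... | inj₂ A₂ᵢⱼ = A₂ᵢⱼ∉ A₂ᵢⱼ

-- Induction on the number of points

extend-by-point : (A : Grid m n) (u : Fin m → ℕ) (v : Fin n → ℕ) (i : Fin m) (j : Fin n) → T (A i j) →
  (∀ (B : Grid m n) u′ v′ → B ⊆G A → ¬ T (B i j) → ColorableOrOverloaded B u′ v′) →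
  ColorableOrOverloaded A u v
extend-by-point {m} {n} A u v i j Aᵢⱼ ih = decide red blue
  where
  A₁ A₂ : Grid m n
  A₁ = A ∖⁅ i , j ⁆
  A₂ = (A ᵀ ∖⁅ j , i ⁆) ᵀ
  A₂⊆A : A₂ ⊆G A
  A₂⊆A x y = ∖-⊆ (A ᵀ) j i y x
  red : ColorableOrOverloaded A u v ⊎ TightBlockThroughRow A₁ u v i
  red = try-paint-red A u v i j (λ u′ → ih A₁ u′ v (∖-⊆ A i j) (∖-∉ A i j))
  -- Painting p blue is painting it red in the transpose, with colours and weights swapped.
  blue : ColorableOrOverloaded (A ᵀ) v u ⊎ TightBlockThroughRow (A₂ ᵀ) v u j
  blue = try-paint-red (A ᵀ) v u j i
           (λ v′ → colorableOrOverloaded-transpose A₂ (ih A₂ u v′ A₂⊆A (∖-∉ (A ᵀ) j i)))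
  decide : ColorableOrOverloaded A u v ⊎ TightBlockThroughRow A₁ u v i →
    ColorableOrOverloaded (A ᵀ) v u ⊎ TightBlockThroughRow (A₂ ᵀ) v u j → ColorableOrOverloaded A u v
  decide (inj₁ result) _             = result
  decide (inj₂ _)      (inj₁ result) = colorableOrOverloaded-transpose (A ᵀ) result
  decide (inj₂ row)    (inj₂ column) = inj₂ (tight-row-and-column⇒overloaded A A₁ A₂
    (∖-⊆ A i j) A₂⊆A Aᵢⱼ (∖-∉ A i j) (∖-∉ (A ᵀ) j i) row column)

colorable-empty : (A : Grid m n) {u : Fin m → ℕ} {v : Fin n → ℕ} → (∀ x y → ¬ T (A x y)) → Colorable A u v
colorable-empty {m} {n} A empty =
  (λ _ _ → true) ,
  (λ x → ≤-trans (count-none n (λ y → empty x y ∘ proj₁ ∘ ∧-elim (A x y))) z≤n) ,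
  (λ y → ≤-trans (count-none m (λ x → empty x y ∘ proj₁ ∘ ∧-elim (A x y))) z≤n)

colorable-or-overloaded : ∀ k (A : Grid m n) u v → card A < k → ColorableOrOverloaded A u v
colorable-or-overloaded (suc k) A u v card< with any? (λ x → any? (λ y → T? (A x y)))
... | no  ∄point        = inj₁ (colorable-empty A (λ x y Aₓᵧ → ∄point (x , y , Aₓᵧ)))
... | yes (i , j , Aᵢⱼ) = extend-by-point A u v i j Aᵢⱼ λ B u′ v′ B⊆A Bᵢⱼ∉ →
  colorable-or-overloaded k B u′ v′ (<-≤-trans (card-< A B B⊆A Aᵢⱼ Bᵢⱼ∉) (≤-pred card<))

hall⇒¬overloaded : (A : Grid m n) {u : Fin m → ℕ} {v : Fin n → ℕ} →
  ((B : Grid m n) → B ⊆G A → HallCondition u v B) → ¬ Overloaded A u v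
hall⇒¬overloaded {m} {n} A {u} {v} hall (P , Q , over) = <⇒≱ over (begin
  load A P Q
    ≤⟨ hall (block A P Q) (λ x y → proj₁ ∘ ∧-elim (A x y)) ⟩
  weight u (π₁ (block A P Q)) + weight v (π₂ (block A P Q))
    ≤⟨ +-mono-≤ (weight-mono u π₁⊆P) (weight-mono v π₂⊆Q) ⟩
  capacity u v P Q ∎)
  where
  open ≤-Reasoning
  π₁⊆P : π₁ (block A P Q) ⊆ P
  π₁⊆P x Bₓ = let (y , Bₓᵧ) = anyFin-witness n _ Bₓ
              in proj₁ (∧-elim (P x) (proj₂ (∧-elim (A x y) Bₓᵧ)))
  π₂⊆Q : π₂ (block A P Q) ⊆ Q
  π₂⊆Q y Bʸ = let (x , Bₓᵧ) = anyFin-witness m _ Bʸ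
              in proj₂ (∧-elim (P x) (proj₂ (∧-elim (A x y) Bₓᵧ)))

painted-≤-weight : (A B : Grid m n) (c : Coloring m n) {u : Fin m → ℕ} → B ⊆G A →
  (∀ x → count n (λ y → A x y ∧ c x y) ≤ u x) →
  sumFin m (λ x → count n (λ y → B x y ∧ c x y)) ≤ weight u (π₁ B)
painted-≤-weight {m} {n} A B c B⊆A red≤ = sumFin-mono m (λ x → count-∩-≤ n (c x) (B⊆A x) (red≤ x))

colorable⇒hall : (A : Grid m n) {u : Fin m → ℕ} {v : Fin n → ℕ} →
  Colorable A u v → (B : Grid m n) → B ⊆G A → HallCondition u v B
colorable⇒hall {m} {n} A {u} {v} (c , red≤ , blue≤) B B⊆A = begin
  card B                              ≡⟨ card-split ⟩
  redB + blueB                        ≡⟨ cong (redB +_) (sumFin-comm m n _) ⟩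
  redB + blueBᵀ                       ≤⟨ +-mono-≤ red-bound blue-bound ⟩
  weight u (π₁ B) + weight v (π₂ B)   ∎
  where
  open ≤-Reasoning
  redB blueB blueBᵀ : ℕ
  redB   = sumFin m (λ x → count n (λ y → B x y ∧ c x y))
  blueB  = sumFin m (λ x → count n (λ y → B x y ∧ not (c x y)))
  blueBᵀ = sumFin n (λ y → count m (λ x → B x y ∧ not (c x y)))
  card-split : card B ≡ redB + blueB
  card-split = trans
    (sumFin-cong m (λ x → trans (sumFin-cong n (λ y → 𝟙-split (B x y) (c x y))) (sumFin-distrib-+ n _ _)))
    (sumFin-distrib-+ m _ _)
  red-bound : redB ≤ weight u (π₁ B)
  red-bound = painted-≤-weight A B c B⊆A red≤
  blue-bound : blueBᵀ ≤ weight v (π₂ B)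
  blue-bound = painted-≤-weight (A ᵀ) (B ᵀ) (λ y x → not (c x y)) (λ y x → B⊆A x y) blue≤

mainTheorem6 : (m n : ℕ) (A : Grid m n) (u : Fin m → ℕ) (v : Fin n → ℕ) →
    Colorable A u v ⇔ ((B : Grid m n) → B ⊆G A → HallCondition u v B)
mainTheorem6 m n A u v = mk⇔ (colorable⇒hall A) λ hall →
  Sum.[ id , ⊥-elim ∘ hall⇒¬overloaded A hall ]′ (colorable-or-overloaded (suc (card A)) A u v ≤-refl)
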